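{- Let $D$ be a finite irreflexive digraph. If every vertex of $D$ is a peak, then $D$ is not strongly chordal.
   Context: A digraph is irreflexive if no vertex has a loop. A vertex $v$ is a peak if there exist vertices $u,w$ with $uv, vw, uw\in E(D)$. $D$ is strongly chordal if its vertices can be ordered $v_1,\dots,v_n$ so that for all $i<j$ and $k<\ell$ ($i,j,k,\ell$ not necessarily all distinct), if $v_iv_k, v_iv_\ell, v_jv_k\in E(D)$ then $v_jv_\ell\in E(D)$; equivalently, the adjacency matrix of $D$ admits a simultaneous row and column permutation with no submatrix $\begin{pmatrix}1&1\\1&0\end{pmatrix}$. -}

module Defs where

open import Data.Nat using (ℕ)
open import Data.Fin using (Fin; _<_)
open import Data.Fin.Permutation using (Permutation′; _⟨$⟩ʳ_)
open import Data.Product using (∃-syntax; _×_)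
open import Relation.Nullary using (¬_)

record Digraph (n : ℕ) : Set₁ where
  field
    E : Fin n → Fin n → Set

open Digraph public

Irreflexive : ∀ {n} → Digraph n → Set
Irreflexive {n} D = (v : Fin n) → ¬ E D v v

IsPeak : ∀ {n} → Digraph n → Fin n → Set
IsPeak {n} D v = ∃[ u ] ∃[ w ] (E D u v × E D v w × E D u w)

-- An ordering v_1,…,v_n of the vertices is a bijection σ : Fin n ↔ Fin n,
-- with v_i = σ ⟨$⟩ʳ i.  It is strong (Γ-free) if for all i<j, k<ℓ:
-- v_i v_k, v_i v_ℓ, v_j v_k ∈ E  ⇒  v_j v_ℓ ∈ E.
StrongOrdering : ∀ {n} → Digraph n → Permutation′ n → Set
StrongOrdering {n} D σ =
  (i j k ℓ : Fin n) → i < j → k < ℓ →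
  E D (σ ⟨$⟩ʳ i) (σ ⟨$⟩ʳ k) →
  E D (σ ⟨$⟩ʳ i) (σ ⟨$⟩ʳ ℓ) →
  E D (σ ⟨$⟩ʳ j) (σ ⟨$⟩ʳ k) →
  E D (σ ⟨$⟩ʳ j) (σ ⟨$⟩ʳ ℓ)

StronglyChordal : ∀ {n} → Digraph n → Set
StronglyChordal {n} D = ∃[ σ ] StrongOrdering D σ

module Submission where

open import Defs
open import Data.Nat using (ℕ; suc)
open import Data.Fin using (Fin; fromℕ; _<_)
open import Data.Fin.Permutation using (Permutation′; _⟨$⟩ʳ_; _⟨$⟩ˡ_; inverseʳ)
open import Data.Fin.Properties using (≤fromℕ; ≤∧≢⇒<)
open import Data.Product using (∃-syntax; _×_; _,_)
open import Relation.Nullary using (¬_)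
open import Relation.Binary.PropositionalEquality using (_≢_; refl; sym; cong)

-- The last vertex of a strong ordering cannot be a peak: its two witnesses
-- come earlier, and the Γ-condition for the rows and columns (witness, last)
-- produces a loop at it.

module _ {n : ℕ} (D : Digraph n) where

  arc⇒≢ : Irreflexive D → ∀ {u v} → E D u v → u ≢ v
  arc⇒≢ irr e refl = irr _ e

  peak-in-positions : (σ : Permutation′ n) → ∀ {v} → IsPeak D v →
    ∃[ i ] ∃[ k ] (E D (σ ⟨$⟩ʳ i) v × E D v (σ ⟨$⟩ʳ k) × E D (σ ⟨$⟩ʳ i) (σ ⟨$⟩ʳ k))
  peak-in-positions σ {v} (u , w , euv , evw , euw) = σ ⟨$⟩ˡ u , σ ⟨$⟩ˡ w , arcs
    where
    arcs : E D (σ ⟨$⟩ʳ (σ ⟨$⟩ˡ u)) v × E D v (σ ⟨$⟩ʳ (σ ⟨$⟩ˡ w)) ×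
           E D (σ ⟨$⟩ʳ (σ ⟨$⟩ˡ u)) (σ ⟨$⟩ʳ (σ ⟨$⟩ˡ w))
    arcs rewrite inverseʳ σ {u} | inverseʳ σ {w} = euv , evw , euw

  strongOrdering-peak⇒loop : (σ : Permutation′ n) → StrongOrdering D σ →
    ∀ {i j k} → i < j → k < j →
    E D (σ ⟨$⟩ʳ i) (σ ⟨$⟩ʳ j) → E D (σ ⟨$⟩ʳ j) (σ ⟨$⟩ʳ k) → E D (σ ⟨$⟩ʳ i) (σ ⟨$⟩ʳ k) →
    E D (σ ⟨$⟩ʳ j) (σ ⟨$⟩ʳ j)
  strongOrdering-peak⇒loop σ so {i} {j} {k} i<j k<j eij ejk eik = so i j k j i<j k<j eik eij ejk

≢fromℕ⇒< : ∀ {n} {i : Fin (suc n)} → i ≢ fromℕ n → i < fromℕ n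
≢fromℕ⇒< {i = i} = ≤∧≢⇒< (≤fromℕ i)

corollary13 : (n : ℕ) (D : Digraph (suc n)) → Irreflexive D →
    ((v : Fin (suc n)) → IsPeak D v) → ¬ StronglyChordal D
corollary13 n D irr peak (σ , so)
  with peak-in-positions D σ {σ ⟨$⟩ʳ fromℕ n} (peak _)
... | i , k , e-in , e-out , e-ik =
  irr last (strongOrdering-peak⇒loop D σ so i<last k<last e-in e-out e-ik)
  where
  last : Fin (suc n)
  last = σ ⟨$⟩ʳ fromℕ n
  i<last : i < fromℕ n
  i<last = ≢fromℕ⇒< λ i≡n → arc⇒≢ D irr e-in (cong (σ ⟨$⟩ʳ_) i≡n)
  k<last : k < fromℕ n
  k<last = ≢fromℕ⇒< λ k≡n → arc⇒≢ D irr e-out (sym (cong (σ ⟨$⟩ʳ_) k≡n))
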